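{- Let $n \geq 1$ and let $R \cong F_{q_1} \times F_{q_2} \times \cdots \times F_{q_n}$ be a finite product of finite fields. Then $\Gamma(R)$ is a connected threshold graph if and only if either $R \cong F_{q_i}$ for some $i$ (i.e. $n=1$), or $R \cong F_{q_i} \times F_{q_j}$ (i.e. $n=2$) where $F_{q_i} \cong \mathbb{Z}_2$.
   Context: For a finite commutative ring $R$ with unity, the zero-divisor graph $\Gamma(R)$ is the simple graph whose vertex set is all of $R$, two distinct vertices $x,y\in R$ being adjacent if and only if $xy=0$ in $R$. A graph is a threshold graph if it can be obtained from the one-vertex graph $K_1$ by repeatedly (any number of times, in any order) adding either an isolated vertex or a dominating vertex (a new vertex adjacent to all existing vertices). -}

module Defs where

open import Data.Nat using (ℕ)
open import Data.Fin using (Fin)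
open import Data.Bool using (Bool; T)
open import Data.Empty using (⊥)
open import Data.Unit using (⊤; tt)
open import Data.Maybe using (Maybe; just; nothing)
open import Data.List using (List; []; _∷_)
open import Data.Product using (Σ; ∃; _×_; _,_)
open import Function.Bundles using (_↔_; Inverse; _⇔_)
open import Relation.Nullary using (¬_)
open import Relation.Binary.PropositionalEquality using (_≡_; _≢_)
open import Relation.Binary.Construct.Closure.ReflexiveTransitive using (Star)
open import Algebra.Structures using (IsCommutativeRing)

-- A finite field of order q is represented on the
-- carrier Fin q (every finite field is isomorphic to one of this form),
-- with propositional equality: a commutative ring with 0 ≠ 1 in which
-- every nonzero element has a multiplicative inverse.

record FiniteField : Set where
  field
    order  : ℕ
    _+_    : Fin order → Fin order → Fin order
    _*_    : Fin order → Fin order → Fin order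
    -_     : Fin order → Fin order
    0#     : Fin order
    1#     : Fin order
    isCommutativeRing : IsCommutativeRing _≡_ _+_ _*_ -_ 0# 1#
    0≢1    : 0# ≢ 1#
    inverse : ∀ x → x ≢ 0# → ∃ λ y → x * y ≡ 1#

  Carrier : Set
  Carrier = Fin order

-- The product ring F₁ × ⋯ × Fₙ of a list of finite fields, with
-- componentwise operations.  (Only zero and multiplication are needed
-- for the zero-divisor graph.)

Prod : List FiniteField → Set
Prod []       = ⊤
Prod (F ∷ Fs) = FiniteField.Carrier F × Prod Fs

zeroP : (Fs : List FiniteField) → Prod Fs
zeroP []       = tt
zeroP (F ∷ Fs) = FiniteField.0# F , zeroP Fs

mulP : (Fs : List FiniteField) → Prod Fs → Prod Fs → Prod Fs
mulP []       _        _        = tt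
mulP (F ∷ Fs) (a , x)  (b , y)  = FiniteField._*_ F a b , mulP Fs x y

record Graph : Set₁ where
  field
    Vertex : Set
    Adj    : Vertex → Vertex → Set

open Graph public

record _≅G_ (G H : Graph) : Set where
  field
    bij      : Vertex G ↔ Vertex H
    adj-pres : ∀ x y → Adj G x y ⇔ Adj H (Inverse.to bij x) (Inverse.to bij y)

Connected : Graph → Set
Connected G = ∀ x y → Star (Adj G) x y

ZDGraph : List FiniteField → Graph
ZDGraph Fs = record
  { Vertex = Prod Fs
  ; Adj    = λ x y → x ≢ y × mulP Fs x y ≡ zeroP Fs
  }

-- Threshold graphs.  A construction sequence is a list of Bools, the
-- head being the most recently added vertex: true = dominating vertex,
-- false = isolated vertex.  The empty sequence gives K₁.

ThV : List Bool → Set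
ThV []       = ⊤
ThV (b ∷ bs) = Maybe (ThV bs)

ThAdj : (bs : List Bool) → ThV bs → ThV bs → Set
ThAdj []       _        _        = ⊥
ThAdj (b ∷ bs) nothing  nothing  = ⊥
ThAdj (b ∷ bs) nothing  (just _) = T b
ThAdj (b ∷ bs) (just _) nothing  = T b
ThAdj (b ∷ bs) (just x) (just y) = ThAdj bs x y

ThGraph : List Bool → Graph
ThGraph bs = record { Vertex = ThV bs ; Adj = ThAdj bs }

IsThreshold : Graph → Set
IsThreshold G = Σ (List Bool) λ bs → G ≅G ThGraph bs

-- Γ(R) is connected through 0, which is adjacent to every vertex.  A threshold graph has no two edges
-- a–b, c–d with a ≁ c and b ≁ d (every induced 2K₂, P₄ or C₄ is of this form).  In F × G with
-- |F|, |G| ≠ 2 the vertices (1,0), (0,1), (x,0), (0,y) with x, y ∉ {0, 1} form such a configuration, and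
-- with three or more factors so do (0,1,1,0), (1,0,0,0), (0,1,0,0), (1,0,1,0).  Conversely Γ(F) is a
-- star centred at 0, and Γ(ℤ₂ × G) is built by peeling off 0 (dominating), the units (1,b) (adjacent
-- only to 0), then the idempotent (1,0) (dominating what is left), leaving the independent set of the
-- (0,b) with b ≠ 0.

module Submission where

open import Defs
open import Level using (0ℓ)
open import Algebra.Structures using (IsCommutativeRing)
open import Data.Bool using (Bool; true; false; T)
open import Data.Bool.Properties using (T-irrelevant)
open import Data.Empty using (⊥-elim)
open import Data.Fin using (Fin; zero; suc)
import Data.Fin.Properties as Fin
open import Data.List using (List; []; _∷_; length; cartesianProduct; allFin)
open import Data.List.Membership.Propositional using (_∈_)
open import Data.List.Membership.Propositional.Properties using (∈-cartesianProduct⁺; ∈-allFin)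
open import Data.List.Relation.Unary.Any using (here)
import Data.List.Relation.Unary.Any as Any
open import Data.Maybe using (just; nothing)
open import Data.Nat using (zero; suc; _≤_)
import Data.Nat.Properties as ℕ
open import Data.Product using (Σ; ∃; ∃₂; _×_; _,_; proj₁; proj₂)
import Data.Product.Properties as Product
open import Data.Sum using (_⊎_; inj₁; inj₂; [_,_]′)
open import Data.Unit using (⊤; tt)
import Data.Unit.Properties as Unit
open import Function.Base using (_∘_; case_of_)
open import Function.Bundles using (_⇔_; mk⇔; mk↔ₛ′; Equivalence; Inverse; Injection)
open import Function.Construct.Composition using (_↔-∘_; _⇔-∘_)
open import Function.Properties.Inverse using (↔⇒↣)
open import Relation.Binary.Construct.Closure.ReflexiveTransitive using (ε; _◅_)
open import Relation.Binary.Definitions using (DecidableEquality)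
open import Relation.Binary.PropositionalEquality
open import Relation.Nullary using (¬_; Dec; yes; no)
open import Relation.Nullary.Decidable using (True; _×-dec_; ¬?; toWitness; fromWitness; decidable-stable)
open import Relation.Unary using (Pred; Decidable; ｛_｝; ∁; _∩_; U; _⊆_; _≐_)
open import Relation.Unary.Properties using (U?; ∁?; _∩?_)

record _≃Th_ (G : Graph) (bs : List Bool) : Set where
  field
    to      : Vertex G → ThV bs
    from    : ThV bs → Vertex G
    to∘from : ∀ y → to (from y) ≡ y
    from∘to : ∀ x → from (to x) ≡ x
    adj⇒    : ∀ x y → Adj G x y → ThAdj bs (to x) (to y)
    adj⇐    : ∀ x y → ThAdj bs (to x) (to y) → Adj G x y

≃Th⇒IsThreshold : ∀ {G bs} → G ≃Th bs → IsThreshold G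
≃Th⇒IsThreshold {G} {bs} I = bs , record
  { bij      = record
    { to        = to
    ; from      = from
    ; to-cong   = cong to
    ; from-cong = cong from
    ; inverse   = (λ {x} eq → trans (cong to eq) (to∘from x))
                , (λ {x} eq → trans (cong from eq) (from∘to x))
    }
  ; adj-pres = λ x y → mk⇔ (adj⇒ x y) (adj⇐ x y)
  }
  where open _≃Th_ I

-- Membership is recorded as True (P? x) rather than P x so that it is proof-irrelevant (member-≡).
Induced : (G : Graph) {P : Pred (Vertex G) 0ℓ} → Decidable P → Graph
Induced G P? = record
  { Vertex = Σ (Vertex G) (λ x → True (P? x))
  ; Adj    = λ x y → Adj G (proj₁ x) (proj₁ y)
  }

module _ {A : Set} {P : Pred A 0ℓ} {P? : Decidable P} where

  member-≡ : ∀ {x y} {p : True (P? x)} {q : True (P? y)} →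
             x ≡ y → _≡_ {A = Σ A (λ z → True (P? z))} (x , p) (y , q)
  member-≡ {p = p} {q} refl = cong (_ ,_) (T-irrelevant p q)

module Peeling (G : Graph) (_≟_ : DecidableEquality (Vertex G))
               (Adj-sym : ∀ {x y} → Adj G x y → Adj G y x)
               (Adj-irrefl : ∀ x → ¬ Adj G x x)
               (elements : List (Vertex G)) (∈-elements : ∀ x → x ∈ elements) where

  _∖｛_｝ : {P : Pred (Vertex G) 0ℓ} → Decidable P → (v : Vertex G) → Decidable (P ∩ ∁ ｛ v ｝)
  P? ∖｛ v ｝ = P? ∩? ∁? (v ≟_)

  Induced-cong : ∀ {P Q : Pred (Vertex G) 0ℓ} {bs} (P? : Decidable P) (Q? : Decidable Q) →
                 P ≐ Q → Induced G P? ≃Th bs → Induced G Q? ≃Th bs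
  Induced-cong P? Q? (P⊆Q , Q⊆P) I = record
    { to      = λ (x , q) → to (x , fromWitness (Q⊆P (toWitness q)))
    ; from    = λ y → let (x , p) = from y in x , fromWitness (P⊆Q (toWitness p))
    ; to∘from = λ y → trans (cong to (member-≡ refl)) (to∘from y)
    ; from∘to = λ (x , q) → member-≡ (cong proj₁ (from∘to (x , fromWitness (Q⊆P (toWitness q)))))
    ; adj⇒    = λ _ _ → adj⇒ _ _
    ; adj⇐    = λ _ _ → adj⇐ _ _
    }
    where open _≃Th_ I

  Induced-U⇒IsThreshold : ∃ (Induced G U? ≃Th_) → IsThreshold G
  Induced-U⇒IsThreshold (bs , I) = ≃Th⇒IsThreshold {bs = bs} record
    { to      = λ x → to (x , tt)
    ; from    = λ y → proj₁ (from y)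
    ; to∘from = to∘from
    ; from∘to = λ x → cong proj₁ (from∘to (x , tt))
    ; adj⇒    = λ x y → adj⇒ (x , tt) (y , tt)
    ; adj⇐    = λ x y → adj⇐ (x , tt) (y , tt)
    }
    where open _≃Th_ I

  Induced-singleton : ∀ {P : Pred (Vertex G) 0ℓ} (P? : Decidable P) w →
                      P w → P ⊆ ｛ w ｝ → Induced G P? ≃Th []
  Induced-singleton P? w w∈P P⊆w = record
    { to      = λ _ → tt
    ; from    = λ _ → w , fromWitness w∈P
    ; to∘from = λ _ → refl
    ; from∘to = λ (x , p) → member-≡ (P⊆w (toWitness p))
    ; adj⇒    = λ (x , p) (y , q) xy →
                Adj-irrefl w (subst₂ (Adj G) (sym (P⊆w (toWitness p))) (sym (P⊆w (toWitness q))) xy)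
    ; adj⇐    = λ _ _ ()
    }

  Uniform : Pred (Vertex G) 0ℓ → Vertex G → Bool → Set
  Uniform P v b = ∀ {x} → P x → v ≢ x → Adj G v x ⇔ T b

  Induced-cons : ∀ {P : Pred (Vertex G) 0ℓ} {b} (P? : Decidable P) v → P v → Uniform P v b →
                 ∃ (Induced G (P? ∖｛ v ｝) ≃Th_) → ∃ (Induced G P? ≃Th_)
  Induced-cons {P} {b} P? v v∈P uniform (bs , I) = b ∷ bs , record
    { to      = λ (x , p) → to′ x (toWitness p) (v ≟ x)
    ; from    = from′
    ; to∘from = to∘from′
    ; from∘to = λ (x , p) → from∘to′ x (toWitness p) (v ≟ x)
    ; adj⇒    = λ (x , p) (y , q) → adj⇒′ (toWitness p) (toWitness q) (v ≟ x) (v ≟ y)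
    ; adj⇐    = λ (x , p) (y , q) → adj⇐′ (toWitness p) (toWitness q) (v ≟ x) (v ≟ y)
    }
    where
    module I = _≃Th_ I

    to′ : ∀ x → P x → Dec (v ≡ x) → ThV (b ∷ bs)
    to′ x p (yes _)   = nothing
    to′ x p (no v≢x) = just (I.to (x , fromWitness (p , v≢x)))

    from′ : ThV (b ∷ bs) → Vertex (Induced G P?)
    from′ nothing  = v , fromWitness v∈P
    from′ (just z) = let (x , r) = I.from z in x , fromWitness (proj₁ (toWitness r))

    to∘from′ : ∀ y → to′ (proj₁ (from′ y)) (toWitness (proj₂ (from′ y))) (v ≟ proj₁ (from′ y)) ≡ y
    to∘from′ nothing with v ≟ v
    ... | yes _  = refl
    ... | no v≢v = ⊥-elim (v≢v refl)
    to∘from′ (just z) = to∘from-just (v ≟ proj₁ (I.from z))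
      where
      to∘from-just : ∀ v≟x → to′ (proj₁ (I.from z)) (toWitness (proj₂ (from′ (just z)))) v≟x ≡ just z
      to∘from-just (yes v≡x) = ⊥-elim (proj₂ (toWitness (proj₂ (I.from z))) v≡x)
      to∘from-just (no _)    = cong just (trans (cong I.to (member-≡ refl)) (I.to∘from z))

    from∘to′ : ∀ x {p′ : True (P? x)} (p : P x) (v≟x : Dec (v ≡ x)) → from′ (to′ x p v≟x) ≡ (x , p′)
    from∘to′ x p (yes refl)  = member-≡ refl
    from∘to′ x p (no v≢x) = member-≡ (cong proj₁ (I.from∘to (x , fromWitness (p , v≢x))))

    adj⇒′ : ∀ {x y} (p : P x) (q : P y) (v≟x : Dec (v ≡ x)) (v≟y : Dec (v ≡ y)) →
            Adj G x y → ThAdj (b ∷ bs) (to′ x p v≟x) (to′ y q v≟y)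
    adj⇒′ p q (yes refl) (yes refl) vv = Adj-irrefl v vv
    adj⇒′ p q (yes refl) (no v≢y)  vy = Equivalence.to (uniform q v≢y) vy
    adj⇒′ p q (no v≢x)  (yes refl) xv = Equivalence.to (uniform p v≢x) (Adj-sym xv)
    adj⇒′ p q (no _)    (no _)     xy = I.adj⇒ _ _ xy

    adj⇐′ : ∀ {x y} (p : P x) (q : P y) (v≟x : Dec (v ≡ x)) (v≟y : Dec (v ≡ y)) →
            ThAdj (b ∷ bs) (to′ x p v≟x) (to′ y q v≟y) → Adj G x y
    adj⇐′ p q (yes refl) (yes refl) ()
    adj⇐′ p q (yes refl) (no v≢y)  tb = Equivalence.from (uniform q v≢y) tb
    adj⇐′ p q (no v≢x)  (yes refl) tb = Adj-sym (Equivalence.from (uniform p v≢x) tb)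
    adj⇐′ p q (no v≢x)  (no v≢y)   xy = I.adj⇐ (_ , fromWitness (p , v≢x)) (_ , fromWitness (q , v≢y)) xy

  Isolated : Pred (Vertex G) 0ℓ → Pred (Vertex G) 0ℓ → Set
  Isolated P Q = ∀ {x y} → P x → Q x → P y → ¬ Adj G x y

  Induced-consIsolated : ∀ {P Q : Pred (Vertex G) 0ℓ} (P? : Decidable P) (Q? : Decidable Q) →
                         Isolated P Q → ∃ (Induced G (P? ∩? ∁? Q?) ≃Th_) → ∃ (Induced G P? ≃Th_)
  Induced-consIsolated {Q = Q} P? Q? = peel elements P? (λ {x} _ _ → ∈-elements x)
    where
    peel : ∀ xs {P} (P? : Decidable P) → (∀ {x} → P x → Q x → x ∈ xs) → Isolated P Q →
           ∃ (Induced G (P? ∩? ∁? Q?) ≃Th_) → ∃ (Induced G P? ≃Th_)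
    peel [] P? covered _ (bs , I) =
      bs , Induced-cong _ P? (proj₁ , λ p → p , λ q → case covered p q of λ ()) I
    peel (v ∷ xs) {P} P? covered isolated (bs , I) with (P? ∩? Q?) v
    ... | no v∉P∩Q =
      peel xs P? (λ p q → Any.tail (λ { refl → v∉P∩Q (p , q) }) (covered p q)) isolated (bs , I)
    ... | yes (v∈P , v∈Q) =
      Induced-cons P? v v∈P (λ x∈P _ → mk⇔ (isolated v∈P v∈Q x∈P) λ ())
        (peel xs (P? ∖｛ v ｝) (λ (p , v≢x) q → Any.tail (v≢x ∘ sym) (covered p q))
          (λ (p , _) q (p′ , _) → isolated p q p′)
          (bs , Induced-cong _ _ v∉P∖Q I))
      where
      v∉P∖Q : P ∩ ∁ Q ≐ (P ∩ ∁ ｛ v ｝) ∩ ∁ Q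
      v∉P∖Q = (λ (p , q) → (p , λ v≡x → q (subst Q v≡x v∈Q)) , q)
            , (λ ((p , _) , q) → p , q)

  Induced-independent : ∀ {P : Pred (Vertex G) 0ℓ} (P? : Decidable P) w → P w →
                        (∀ {x y} → P x → P y → ¬ Adj G x y) → ∃ (Induced G P? ≃Th_)
  Induced-independent P? w w∈P independent =
    Induced-consIsolated P? (∁? (w ≟_)) (λ p _ q → independent p q)
      ([] , Induced-singleton _ w (w∈P , λ w≢w → w≢w refl) λ (_ , ¬w≢x) → decidable-stable (w ≟ _) ¬w≢x)

module FieldProperties (F : FiniteField) where
  open FiniteField F
  open IsCommutativeRing isCommutativeRing using (zeroʳ; *-identityˡ; *-comm; *-assoc)

  zeroProduct : ∀ x y → x * y ≡ 0# → x ≡ 0# ⊎ y ≡ 0#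
  zeroProduct x y xy≡0 with x Fin.≟ 0#
  ... | yes x≡0 = inj₁ x≡0
  ... | no x≢0 with inverse x x≢0
  ... | x⁻¹ , xx⁻¹≡1 = inj₂ (begin
    y               ≡⟨ sym (*-identityˡ y) ⟩
    1# * y          ≡⟨ cong (_* y) (trans (sym xx⁻¹≡1) (*-comm x x⁻¹)) ⟩
    (x⁻¹ * x) * y   ≡⟨ *-assoc x⁻¹ x y ⟩
    x⁻¹ * (x * y)   ≡⟨ cong (x⁻¹ *_) xy≡0 ⟩
    x⁻¹ * 0#        ≡⟨ zeroʳ x⁻¹ ⟩
    0#              ∎)
    where open ≡-Reasoning

  *-nonzero : ∀ {x y} → x ≢ 0# → y ≢ 0# → x * y ≢ 0#
  *-nonzero x≢0 y≢0 xy≡0 = [ x≢0 , y≢0 ]′ (zeroProduct _ _ xy≡0)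

-- Stated for n ≡ 2 rather than Fin 2 so that it applies to Fin (FiniteField.order F).
one-of-two : ∀ {n} → n ≡ 2 → (a b c : Fin n) → b ≢ c → a ≡ b ⊎ a ≡ c
one-of-two refl zero       zero       _          _   = inj₁ refl
one-of-two refl zero       (suc zero) zero       _   = inj₂ refl
one-of-two refl (suc zero) zero       (suc zero) _   = inj₂ refl
one-of-two refl (suc zero) (suc zero) _          _   = inj₁ refl
one-of-two refl _          zero       zero       b≢c = ⊥-elim (b≢c refl)
one-of-two refl _          (suc zero) (suc zero) b≢c = ⊥-elim (b≢c refl)

third-element : ∀ {n} → n ≢ 2 → (b c : Fin n) → b ≢ c → ∃ λ a → a ≢ b × a ≢ c
third-element {suc (suc zero)}    n≢2 _             _             _   = ⊥-elim (n≢2 refl)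
third-element {suc zero}          _   zero          zero          b≢c = ⊥-elim (b≢c refl)
third-element {suc (suc (suc _))} _   zero          zero          b≢c = ⊥-elim (b≢c refl)
third-element {suc (suc (suc _))} _   zero          (suc zero)    _   = suc (suc zero) , (λ ()) , (λ ())
third-element {suc (suc (suc _))} _   zero          (suc (suc _)) _   = suc zero , (λ ()) , (λ ())
third-element {suc (suc (suc _))} _   (suc zero)    zero          _   = suc (suc zero) , (λ ()) , (λ ())
third-element {suc (suc (suc _))} _   (suc (suc _)) zero          _   = suc zero , (λ ()) , (λ ())
third-element {suc (suc (suc _))} _   (suc _)       (suc _)       _   = zero , (λ ()) , (λ ())

≟-Prod : ∀ Fs → DecidableEquality (Prod Fs)
≟-Prod []       = Unit._≟_
≟-Prod (F ∷ Fs) = Product.≡-dec Fin._≟_ (≟-Prod Fs)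

elementsP : ∀ Fs → List (Prod Fs)
elementsP []       = tt ∷ []
elementsP (F ∷ Fs) = cartesianProduct (allFin _) (elementsP Fs)

∈-elementsP : ∀ Fs x → x ∈ elementsP Fs
∈-elementsP []       tt      = here refl
∈-elementsP (F ∷ Fs) (a , x) = ∈-cartesianProduct⁺ (∈-allFin a) (∈-elementsP Fs x)

mulP-zeroˡ : ∀ Fs x → mulP Fs (zeroP Fs) x ≡ zeroP Fs
mulP-zeroˡ []       _       = refl
mulP-zeroˡ (F ∷ Fs) (a , x) =
  cong₂ _,_ (IsCommutativeRing.zeroˡ (FiniteField.isCommutativeRing F) a) (mulP-zeroˡ Fs x)

mulP-comm : ∀ Fs x y → mulP Fs x y ≡ mulP Fs y x
mulP-comm []       _       _       = refl
mulP-comm (F ∷ Fs) (a , x) (b , y) =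
  cong₂ _,_ (IsCommutativeRing.*-comm (FiniteField.isCommutativeRing F) a b) (mulP-comm Fs x y)

module ZeroDivisorGraph (Fs : List FiniteField) where

  Γ : Graph
  Γ = ZDGraph Fs

  0ᴾ : Prod Fs
  0ᴾ = zeroP Fs

  Nonzero : Pred (Prod Fs) 0ℓ
  Nonzero = U ∩ ∁ ｛ 0ᴾ ｝

  Γ-sym : ∀ {x y} → Adj Γ x y → Adj Γ y x
  Γ-sym {x} {y} (x≢y , xy≡0) = (λ y≡x → x≢y (sym y≡x)) , trans (mulP-comm Fs y x) xy≡0

  Γ-irrefl : ∀ x → ¬ Adj Γ x x
  Γ-irrefl x (x≢x , _) = x≢x refl

  zero-adjacent : ∀ {x} → 0ᴾ ≢ x → Adj Γ 0ᴾ x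
  zero-adjacent {x} 0≢x = 0≢x , mulP-zeroˡ Fs x

  Γ-connected : Connected Γ
  Γ-connected x y with ≟-Prod Fs x y | ≟-Prod Fs 0ᴾ x | ≟-Prod Fs 0ᴾ y
  ... | yes refl | _        | _        = ε
  ... | no x≢y   | yes refl | _        = zero-adjacent x≢y ◅ ε
  ... | no x≢y   | no _     | yes refl = Γ-sym (zero-adjacent (λ 0≡x → x≢y (sym 0≡x))) ◅ ε
  ... | no _     | no 0≢x   | no 0≢y   = Γ-sym (zero-adjacent 0≢x) ◅ zero-adjacent 0≢y ◅ ε

  open Peeling Γ (≟-Prod Fs) Γ-sym Γ-irrefl (elementsP Fs) (∈-elementsP Fs) public

  threshold-via-nonzero : ∃ (Induced Γ (U? ∖｛ 0ᴾ ｝) ≃Th_) → IsThreshold Γ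
  threshold-via-nonzero =
    Induced-U⇒IsThreshold ∘ Induced-cons U? 0ᴾ tt (λ _ 0≢x → mk⇔ (λ _ → tt) (λ _ → zero-adjacent 0≢x))

field-threshold : ∀ F → IsThreshold (ZDGraph (F ∷ []))
field-threshold F =
  threshold-via-nonzero (Induced-independent _ (F.1# , tt) (tt , λ 0≡1 → F.0≢1 (cong proj₁ 0≡1)) independent)
  where
  module F = FiniteField F
  open ZeroDivisorGraph (F ∷ [])
  nonzero : ∀ {x} → Nonzero x → proj₁ x ≢ F.0#
  nonzero (_ , 0≢x) x≡0 = 0≢x (cong (_, tt) (sym x≡0))
  independent : ∀ {x y} → Nonzero x → Nonzero y → ¬ Adj Γ x y
  independent x≢0 y≢0 (_ , xy≡0) = FieldProperties.*-nonzero F (nonzero x≢0) (nonzero y≢0) (cong proj₁ xy≡0)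

module Z₂× (F G : FiniteField) (|F|≡2 : FiniteField.order F ≡ 2) where
  module F = FiniteField F
  module G = FiniteField G
  module RF = IsCommutativeRing F.isCommutativeRing
  module RG = IsCommutativeRing G.isCommutativeRing
  open ZeroDivisorGraph (F ∷ G ∷ [])
  open FieldProperties G using (zeroProduct; *-nonzero)

  ⟨_,_⟩ : F.Carrier → G.Carrier → Prod (F ∷ G ∷ [])
  ⟨ a , b ⟩ = a , b , tt

  snd : Prod (F ∷ G ∷ []) → G.Carrier
  snd = proj₁ ∘ proj₂

  IsUnit : Pred (Prod (F ∷ G ∷ [])) 0ℓ
  IsUnit x = proj₁ x ≡ F.1# × snd x ≢ G.0#

  isUnit? : Decidable IsUnit
  isUnit? x = (proj₁ x Fin.≟ F.1#) ×-dec ¬? (snd x Fin.≟ G.0#)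

  e f : Prod (F ∷ G ∷ [])
  e = ⟨ F.1# , G.0# ⟩
  f = ⟨ F.0# , G.1# ⟩

  Rest : Pred (Prod (F ∷ G ∷ [])) 0ℓ
  Rest = (Nonzero ∩ ∁ IsUnit) ∩ ∁ ｛ e ｝

  first-zero : ∀ {x} → (Nonzero ∩ ∁ IsUnit) x → e ≢ x → proj₁ x ≡ F.0#
  first-zero {a , b , tt} (_ , ¬unit) e≢x with one-of-two |F|≡2 a F.0# F.1# F.0≢1 | b Fin.≟ G.0#
  ... | inj₁ a≡0    | _        = a≡0
  ... | inj₂ refl   | yes refl = ⊥-elim (e≢x refl)
  ... | inj₂ a≡1    | no b≢0   = ⊥-elim (¬unit (a≡1 , b≢0))

  second-nonzero : ∀ {x} → Nonzero x → proj₁ x ≡ F.0# → snd x ≢ G.0#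
  second-nonzero (_ , 0≢x) a≡0 b≡0 = 0≢x (cong₂ ⟨_,_⟩ (sym a≡0) (sym b≡0))

  units-isolated : Isolated Nonzero IsUnit
  units-isolated {a , b , tt} {c , d , tt} _ (refl , b≢0) (_ , 0≢y) (_ , xy≡0)
    with zeroProduct b d (cong snd xy≡0)
  ... | inj₁ b≡0 = b≢0 b≡0
  ... | inj₂ d≡0 = 0≢y (cong₂ ⟨_,_⟩ (sym c≡0) (sym d≡0))
    where c≡0 = trans (sym (RF.*-identityˡ c)) (cong proj₁ xy≡0)

  e-dominates : Uniform (Nonzero ∩ ∁ IsUnit) e true
  e-dominates x∈ e≢x = mk⇔ (λ _ → tt) λ _ →
    e≢x , cong₂ ⟨_,_⟩ (trans (RF.*-identityˡ _) (first-zero x∈ e≢x)) (RG.zeroˡ _)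

  rest-independent : ∀ {x y} → Rest x → Rest y → ¬ Adj Γ x y
  rest-independent (x∈ , e≢x) (y∈ , e≢y) (_ , xy≡0) =
    *-nonzero (second-nonzero (proj₁ x∈) (first-zero x∈ e≢x))
              (second-nonzero (proj₁ y∈) (first-zero y∈ e≢y)) (cong snd xy≡0)

  e∈ : (Nonzero ∩ ∁ IsUnit) e
  e∈ = (tt , λ 0≡e → F.0≢1 (cong proj₁ 0≡e)) , λ (_ , 0≢0) → 0≢0 refl

  f∈Rest : Rest f
  f∈Rest = ((tt , λ 0≡f → G.0≢1 (cong snd 0≡f)) , λ (0≡1 , _) → F.0≢1 0≡1)
         , λ e≡f → F.0≢1 (sym (cong proj₁ e≡f))

  threshold : IsThreshold Γ
  threshold = threshold-via-nonzero
    (Induced-consIsolated (U? ∖｛ 0ᴾ ｝) isUnit? units-isolated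
      (Induced-cons _ e e∈ e-dominates
        (Induced-independent _ f f∈Rest rest-independent)))

IsThreshold-≅ : ∀ {G H} → G ≅G H → IsThreshold H → IsThreshold G
IsThreshold-≅ G≅H (bs , H≅T) = bs , record
  { bij      = bij H≅T ↔-∘ bij G≅H
  ; adj-pres = λ x y → adj-pres H≅T _ _ ⇔-∘ adj-pres G≅H x y
  }
  where open _≅G_

ZD-swap : ∀ F G → ZDGraph (F ∷ G ∷ []) ≅G ZDGraph (G ∷ F ∷ [])
ZD-swap F G = record
  { bij      = mk↔ₛ′ swap₂ swap₂ (λ _ → refl) (λ _ → refl)
  ; adj-pres = λ _ _ → mk⇔ (swap-adj {F} {G}) (swap-adj {G} {F})
  }
  where
  swap₂ : ∀ {A B : Set} → A × B × ⊤ → B × A × ⊤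
  swap₂ (a , b , tt) = b , a , tt
  swap-adj : ∀ {H K : FiniteField} {x y} →
             Adj (ZDGraph (H ∷ K ∷ [])) x y → Adj (ZDGraph (K ∷ H ∷ [])) (swap₂ x) (swap₂ y)
  swap-adj (x≢y , xy≡0) = x≢y ∘ cong swap₂ , cong swap₂ xy≡0

record AlternatingSquare (G : Graph) : Set where
  constructor square
  field
    {a b c d} : Vertex G
    a–b : Adj G a b
    c–d : Adj G c d
    a≁c : ¬ Adj G a c
    b≁d : ¬ Adj G b d
    a≢c : a ≢ c
    b≢d : b ≢ d

ThGraph-noAlternatingSquare : ∀ bs → ¬ AlternatingSquare (ThGraph bs)
ThGraph-noAlternatingSquare [] (square () _ _ _ _ _)
ThGraph-noAlternatingSquare (b ∷ bs) (square {just _} {just _} {just _} {just _} ab cd a≁c b≁d a≢c b≢d) =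
  ThGraph-noAlternatingSquare bs (square ab cd a≁c b≁d (a≢c ∘ cong just) (b≢d ∘ cong just))
ThGraph-noAlternatingSquare (true ∷ _) (square {nothing} {_} {nothing} _ _ _ _ a≢c _) = a≢c refl
ThGraph-noAlternatingSquare (true ∷ _) (square {nothing} {_} {just _} _ _ a≁c _ _ _)  = a≁c tt
ThGraph-noAlternatingSquare (true ∷ _) (square {just _} {_} {nothing} _ _ a≁c _ _ _)  = a≁c tt
ThGraph-noAlternatingSquare (true ∷ _) (square {just _} {nothing} {just _} {nothing} _ _ _ _ _ b≢d) = b≢d refl
ThGraph-noAlternatingSquare (true ∷ _) (square {just _} {nothing} {just _} {just _} _ _ _ b≁d _ _) = b≁d tt
ThGraph-noAlternatingSquare (true ∷ _) (square {just _} {just _} {just _} {nothing} _ _ _ b≁d _ _) = b≁d tt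
ThGraph-noAlternatingSquare (false ∷ _) (square {nothing} {nothing} () _ _ _ _ _)
ThGraph-noAlternatingSquare (false ∷ _) (square {nothing} {just _} () _ _ _ _ _)
ThGraph-noAlternatingSquare (false ∷ _) (square {just _} {nothing} () _ _ _ _ _)
ThGraph-noAlternatingSquare (false ∷ _) (square {just _} {just _} {nothing} {nothing} _ () _ _ _ _)
ThGraph-noAlternatingSquare (false ∷ _) (square {just _} {just _} {nothing} {just _} _ () _ _ _ _)
ThGraph-noAlternatingSquare (false ∷ _) (square {just _} {just _} {just _} {nothing} _ () _ _ _ _)

IsThreshold⇒noAlternatingSquare : ∀ {G} → IsThreshold G → ¬ AlternatingSquare G
IsThreshold⇒noAlternatingSquare {G} (bs , G≅T) (square ab cd a≁c b≁d a≢c b≢d) =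
  ThGraph-noAlternatingSquare bs
    (square (adj⇒ ab) (adj⇒ cd) (a≁c ∘ adj⇐) (b≁d ∘ adj⇐) (a≢c ∘ to-injective) (b≢d ∘ to-injective))
  where
  open _≅G_ G≅T
  adj⇒ : ∀ {x y} → Adj G x y → ThAdj bs (Inverse.to bij x) (Inverse.to bij y)
  adj⇒ = Equivalence.to (adj-pres _ _)
  adj⇐ : ∀ {x y} → ThAdj bs (Inverse.to bij x) (Inverse.to bij y) → Adj G x y
  adj⇐ = Equivalence.from (adj-pres _ _)
  to-injective : ∀ {x y} → Inverse.to bij x ≡ Inverse.to bij y → x ≡ y
  to-injective = Injection.injective (↔⇒↣ bij)

large-square : ∀ F G → FiniteField.order F ≢ 2 → FiniteField.order G ≢ 2 →
               AlternatingSquare (ZDGraph (F ∷ G ∷ []))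
large-square F G |F|≢2 |G|≢2 =
  let x , x≢0 , x≢1 = third-element |F|≢2 F.0# F.1# F.0≢1
      y , y≢0 , y≢1 = third-element |G|≢2 G.0# G.1# G.0≢1
  in square {a = ⟨ F.1# , G.0# ⟩} {b = ⟨ F.0# , G.1# ⟩} {c = ⟨ x , G.0# ⟩} {d = ⟨ F.0# , y ⟩}
       (F.0≢1 ∘ sym ∘ cong proj₁ , cong₂ ⟨_,_⟩ (RF.zeroʳ _) (RG.zeroˡ _))
       (x≢0 ∘ cong proj₁ , cong₂ ⟨_,_⟩ (RF.zeroʳ _) (RG.zeroˡ _))
       (λ (_ , ac≡0) → FF.*-nonzero (F.0≢1 ∘ sym) x≢0 (cong proj₁ ac≡0))
       (λ (_ , bd≡0) → FG.*-nonzero (G.0≢1 ∘ sym) y≢0 (cong (proj₁ ∘ proj₂) bd≡0))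
       (x≢1 ∘ sym ∘ cong proj₁)
       (y≢1 ∘ sym ∘ cong (proj₁ ∘ proj₂))
  where
  module F = FiniteField F
  module G = FiniteField G
  module RF = IsCommutativeRing F.isCommutativeRing
  module RG = IsCommutativeRing G.isCommutativeRing
  module FF = FieldProperties F
  module FG = FieldProperties G
  ⟨_,_⟩ : F.Carrier → G.Carrier → Prod (F ∷ G ∷ [])
  ⟨ a , b ⟩ = a , b , tt

three-factor-square : ∀ F G H Fs → AlternatingSquare (ZDGraph (F ∷ G ∷ H ∷ Fs))
three-factor-square F G H Fs =
  square {a = ⟨ F.0# , G.1# , H.1# ⟩} {b = ⟨ F.1# , G.0# , H.0# ⟩}
         {c = ⟨ F.0# , G.1# , H.0# ⟩} {d = ⟨ F.1# , G.0# , H.1# ⟩}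
    (F.0≢1 ∘ cong proj₁ , zero-components (RF.zeroˡ _) (RG.zeroʳ _) (RH.zeroʳ _))
    (F.0≢1 ∘ cong proj₁ , zero-components (RF.zeroˡ _) (RG.zeroʳ _) (RH.zeroˡ _))
    (λ (_ , ac≡0) → FG.*-nonzero (G.0≢1 ∘ sym) (G.0≢1 ∘ sym) (cong (proj₁ ∘ proj₂) ac≡0))
    (λ (_ , bd≡0) → FF.*-nonzero (F.0≢1 ∘ sym) (F.0≢1 ∘ sym) (cong proj₁ bd≡0))
    (H.0≢1 ∘ sym ∘ cong (proj₁ ∘ proj₂ ∘ proj₂))
    (H.0≢1 ∘ cong (proj₁ ∘ proj₂ ∘ proj₂))
  where
  module F = FiniteField F
  module G = FiniteField G
  module H = FiniteField H
  module RF = IsCommutativeRing F.isCommutativeRing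
  module RG = IsCommutativeRing G.isCommutativeRing
  module RH = IsCommutativeRing H.isCommutativeRing
  module FF = FieldProperties F
  module FG = FieldProperties G
  ⟨_,_,_⟩ : F.Carrier → G.Carrier → H.Carrier → Prod (F ∷ G ∷ H ∷ Fs)
  ⟨ a , b , c ⟩ = a , b , c , zeroP Fs
  zero-components : ∀ {a b c x} → a ≡ F.0# → b ≡ G.0# → c ≡ H.0# →
                    _≡_ {A = Prod (F ∷ G ∷ H ∷ Fs)} (a , b , c , mulP Fs (zeroP Fs) x) (zeroP (F ∷ G ∷ H ∷ Fs))
  zero-components refl refl refl = cong (λ t → _ , _ , _ , t) (mulP-zeroˡ Fs _)

mainTheorem3 : (Fs : List FiniteField) → 1 ≤ length Fs →
    (Connected (ZDGraph Fs) × IsThreshold (ZDGraph Fs))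
    ⇔ (length Fs ≡ 1
    ⊎ ∃₂ λ F G → Fs ≡ F ∷ G ∷ []
    × (FiniteField.order F ≡ 2 ⊎ FiniteField.order G ≡ 2))
mainTheorem3 Fs 1≤n =
  mk⇔ (λ (_ , threshold) → classify Fs 1≤n threshold)
      (λ shape → ZeroDivisorGraph.Γ-connected Fs , construct Fs shape)
  where
  classify : ∀ Fs → 1 ≤ length Fs → IsThreshold (ZDGraph Fs) →
             length Fs ≡ 1 ⊎ ∃₂ λ F G → Fs ≡ F ∷ G ∷ [] × (FiniteField.order F ≡ 2 ⊎ FiniteField.order G ≡ 2)
  classify (F ∷ []) _ _ = inj₁ refl
  classify (F ∷ G ∷ []) _ threshold with FiniteField.order F ℕ.≟ 2 | FiniteField.order G ℕ.≟ 2
  ... | yes |F|≡2 | _         = inj₂ (F , G , refl , inj₁ |F|≡2)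
  ... | no _      | yes |G|≡2 = inj₂ (F , G , refl , inj₂ |G|≡2)
  ... | no |F|≢2  | no |G|≢2  =
    ⊥-elim (IsThreshold⇒noAlternatingSquare threshold (large-square F G |F|≢2 |G|≢2))
  classify (F ∷ G ∷ H ∷ Fs) _ threshold =
    ⊥-elim (IsThreshold⇒noAlternatingSquare threshold (three-factor-square F G H Fs))

  construct : ∀ Fs →
              length Fs ≡ 1 ⊎ ∃₂ (λ F G → Fs ≡ F ∷ G ∷ [] × (FiniteField.order F ≡ 2 ⊎ FiniteField.order G ≡ 2)) →
              IsThreshold (ZDGraph Fs)
  construct (F ∷ []) (inj₁ _) = field-threshold F
  construct _ (inj₂ (F , G , refl , inj₁ |F|≡2)) = Z₂×.threshold F G |F|≡2
  construct _ (inj₂ (F , G , refl , inj₂ |G|≡2)) = IsThreshold-≅ (ZD-swap F G) (Z₂×.threshold G F |G|≡2)
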